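{- Let $\lambda=(\lambda_1\ge\dots\ge\lambda_\ell\ge1)$ be a nonempty partition whose largest part equals its number of parts, $\lambda_1=\ell$, and such that for every $i$ with $1\le i\le \ell-1$ the $i$-th smallest part $\lambda_{\ell+1-i}$ is strictly greater than $i$. Then $Hk(\lambda)=\{1,2,\dots,h\}$, where $h$ is the largest element of $Hk(\lambda)$.
   Context: For a partition $\lambda=(\lambda_1\ge\dots\ge\lambda_\ell\ge1)$, the hook length of cell $(i,j)$ ($1\le i\le \ell$, $1\le j\le\lambda_i$) is $h_{ij}=\lambda_i-j+\lambda'_j-i+1$ with $\lambda'_j=|\{a:\lambda_a\ge j\}|$, and $Hk(\lambda)$ denotes the set of all hook lengths of $\lambda$. (Such $\lambda$ are called strict Dyck paths.) -}

module Defs where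

open import Data.Nat using (ℕ; zero; suc; _+_; _∸_; _≤_; _<_; _≥_; _>_)
open import Data.List using (List; []; _∷_; length; lookup; filter)
open import Data.Fin using (Fin; toℕ; fromℕ<)
open import Data.Product using (Σ; ∃; _×_; _,_)
open import Data.Nat.Properties using (_≤?_)
open import Relation.Binary.PropositionalEquality using (_≡_)

-- A partition λ = (λ₁ ≥ … ≥ λ_ℓ ≥ 1) is represented by the list [λ₁, …, λ_ℓ].
-- part λ i  = λ_i for 1 ≤ i ≤ ℓ (1-indexed), and 0 otherwise.
part : List ℕ → ℕ → ℕ
part []       _             = 0
part (x ∷ xs) zero          = 0
part (x ∷ xs) (suc zero)    = x
part (x ∷ xs) (suc (suc i)) = part xs (suc i)

len : List ℕ → ℕ
len = length

IsPartition : List ℕ → Set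
IsPartition λs = (∀ i → 1 ≤ i → i ≤ len λs → 1 ≤ part λs i)
               × (∀ i → 1 ≤ i → i < len λs → part λs (suc i) ≤ part λs i)

conj : List ℕ → ℕ → ℕ
conj λs j = length (filter (λ x → j ≤? x) λs)

IsCell : List ℕ → ℕ → ℕ → Set
IsCell λs i j = 1 ≤ i × i ≤ len λs × 1 ≤ j × j ≤ part λs i

-- hook length h_{ij} = λ_i - j + λ'_j - i + 1   (nonnegative on cells)
hook : List ℕ → ℕ → ℕ → ℕ
hook λs i j = ((part λs i ∸ j) + (conj λs j ∸ i)) + 1

InHk : List ℕ → ℕ → Set
InHk λs h = Σ ℕ λ i → Σ ℕ λ j → IsCell λs i j × hook λs i j ≡ h

module Submission where

-- Write ℓ for the number of parts and P i = λ_i.  Row i reaches a value k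
-- when k ≤ P i + ℓ - i (its first-column hook); a reaching row contains a
-- cell of hook length k unless k is a "gap" k = (P i - i) - (P t - t) for
-- some row t, since the hooks of row i run through intervals separated by
-- exactly these values (row-hook, via a discrete intermediate value theorem).
-- The corner hook h = hook(1,1) is the largest hook of any partition.
--
-- For a strict Dyck path and 1 ≤ k ≤ h, if every reaching row were blocked
-- by a gap, the blocking rows would strictly increase along the reaching
-- rows 1..n (blocked-increase, blocked-chain); the hypothesis
-- λ_a + a ≥ ℓ + 2 (a ≥ 2), applied to the blocking row of row 1 and to row
-- n + 1, makes this numerically impossible (blocking-arith).  A decidable
-- search thus finds an unblocked reaching row, and row-hook puts k in Hk(λ).

open import Defs
open import Data.Nat using (ℕ; zero; suc; _+_; _∸_; _≤_; _<_; _>_; z≤n; s≤s; _≤?_; _<?_; _≟_)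
open import Data.Nat.Properties
open import Data.List using (List; []; _∷_; length)
open import Data.List.Properties using (filter-accept; filter-reject; length-filter)
open import Data.Product using (Σ; _×_; _,_; proj₁; proj₂)
open import Data.Sum using (_⊎_; inj₁; inj₂)
open import Data.Empty using (⊥; ⊥-elim)
open import Relation.Nullary using (¬_; Dec; yes; no)
open import Relation.Nullary.Decidable using (toSum)
open import Relation.Binary.PropositionalEquality using (_≡_; refl; sym; trans; cong; cong₂; subst; module ≡-Reasoning)
open import Data.Nat.Tactic.RingSolver using (solve-∀)

boundedSearch : (A B : ℕ → Set) → (∀ n → A n ⊎ B n) → ∀ N →
  Σ ℕ (λ n → 1 ≤ n × n ≤ N × A n) ⊎ (∀ n → 1 ≤ n → n ≤ N → B n)
boundedSearch A B classify zero = inj₂ (λ n n≥1 n≤0 → ⊥-elim (<⇒≱ n≥1 n≤0))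
boundedSearch A B classify (suc N) with boundedSearch A B classify N | classify (suc N)
... | inj₁ (n , n≥1 , n≤N , a) | _     = inj₁ (n , n≥1 , m≤n⇒m≤1+n n≤N , a)
... | inj₂ _                    | inj₁ a = inj₁ (suc N , s≤s z≤n , ≤-refl , a)
... | inj₂ allB                 | inj₂ b = inj₂ extend
  where
  extend : ∀ n → 1 ≤ n → n ≤ suc N → B n
  extend n n≥1 n≤sN with m≤n⇒m<n∨m≡n n≤sN
  ... | inj₁ n<sN = allB n n≥1 (≤-pred n<sN)
  ... | inj₂ refl = b

crossing : (Q : ℕ → Set) → (∀ n → Dec (Q n)) → ∀ {a} b → a ≤ b → Q a → ¬ Q b →
  Σ ℕ (λ m → a ≤ m × m < b × Q m × ¬ Q (suc m))
crossing Q Q? zero z≤n qa ¬qb = ⊥-elim (¬qb qa)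
crossing Q Q? (suc b) a≤sb qa ¬qsb with m≤n⇒m<n∨m≡n a≤sb
... | inj₂ refl = ⊥-elim (¬qsb qa)
... | inj₁ a<sb with Q? b
...   | yes qb = b , ≤-pred a<sb , ≤-refl , qb , ¬qsb
...   | no ¬qb with crossing Q Q? b (≤-pred a<sb) qa ¬qb
...     | m , a≤m , m<b , qm , ¬qsm = m , a≤m , m<n⇒m<1+n m<b , qm , ¬qsm

part-outside : ∀ xs a → len xs < a → part xs a ≡ 0
part-outside []       a             _          = refl
part-outside (x ∷ xs) (suc zero)    (s≤s ())
part-outside (x ∷ xs) (suc (suc a)) (s≤s a>ℓ) = part-outside xs (suc a) a>ℓ

conj-exact : ∀ xs j m → (∀ a → 1 ≤ a → a ≤ m → j ≤ part xs a) →
  (∀ a → m < a → part xs a < j) → conj xs j ≡ m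
conj-exact []       j zero    above below = refl
conj-exact []       j (suc m) above below with above 1 (s≤s z≤n) (s≤s z≤n) | below (suc (suc m)) ≤-refl
... | z≤n | ()
conj-exact (x ∷ xs) j zero    above below =
  trans (cong length (filter-reject (j ≤?_) {x} {xs} (<⇒≱ (below 1 (s≤s z≤n)))))
        (conj-exact xs j zero (λ a a≥1 a≤0 → ⊥-elim (<⇒≱ a≥1 a≤0))
                              (λ { (suc a) _ → below (suc (suc a)) (s≤s z≤n) }))
conj-exact (x ∷ xs) j (suc m) above below =
  trans (cong length (filter-accept (j ≤?_) {x} {xs} (above 1 (s≤s z≤n) (s≤s z≤n))))
        (cong suc (conj-exact xs j m
          (λ { (suc a) _ a≤m → above (suc (suc a)) (s≤s z≤n) (s≤s a≤m) })
          (λ { (suc a) m<a → below (suc (suc a)) (s≤s m<a) })))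

hook-positive : ∀ xs {k} → InHk xs k → 1 ≤ k
hook-positive xs (i , j , _ , refl) = m≤n+m 1 _

-- The hook of cell (i , j) whose column ends in row m, solved for k.
hook-arith : ∀ {p j m i k} → j ≤ p → i ≤ m → j + (k + i) ≡ p + suc m →
  (p ∸ j) + (m ∸ i) + 1 ≡ k
hook-arith {j = j} {i = i} {k} j≤p i≤m e with m≤n⇒∃[o]m+o≡n j≤p | m≤n⇒∃[o]m+o≡n i≤m
... | u , refl | v , refl =
  begin
    (j + u ∸ j) + (i + v ∸ i) + 1 ≡⟨ cong₂ (λ x y → x + y + 1) (m+n∸m≡n j u) (m+n∸m≡n i v) ⟩
    u + v + 1                     ≡⟨ sym (+-cancelʳ-≡ i k (u + v + 1)
                                       (+-cancelˡ-≡ j (k + i) (u + v + 1 + i)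
                                         (trans e (regroup j u i v)))) ⟩
    k                             ∎
  where
  open ≡-Reasoning
  regroup : ∀ j u i v → j + u + suc (i + v) ≡ j + (u + v + 1 + i)
  regroup = solve-∀

pred-sum : ∀ {a b} → 1 ≤ a → 1 ≤ b → (a ∸ 1) + (b ∸ 1) + 1 + 1 ≡ a + b
pred-sum {suc a} {suc b} _ _ = shift a b
  where
  shift : ∀ a b → a + b + 1 + 1 ≡ suc a + suc b
  shift = solve-∀

-- The numerical core of the blocking argument (ps = P s, p = P (d + 2)).
blocking-arith : ∀ {L ps s p d k} → ps + (k + 1) ≡ L + s → L + 2 ≤ ps + s →
  L + 2 ≤ p + suc (suc d) → suc (p + L) ≤ k + suc (suc d) → s + d ≤ L → ⊥
blocking-arith {L} {ps} {s} {p} {d} {k} e row-s row-n gap-n s+d≤L =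
  m+1+n≰m right (subst (_≤ right) (excess L ps s p d k) total)
  where
  row-s′ : L + 2 + (k + 1) ≤ L + s + s
  row-s′ = ≤-trans (+-monoˡ-≤ (k + 1) row-s)
                   (≤-reflexive (trans (swap ps s (k + 1)) (cong (_+ s) e)))
    where
    swap : ∀ a b c → a + b + c ≡ a + c + b
    swap = solve-∀
  right : ℕ
  right = (p + suc (suc d)) + (k + suc (suc d)) + (L + s + s) + L + L
  total : (L + 2) + suc (p + L) + (L + 2 + (k + 1)) + (s + d) + (s + d) ≤ right
  total = +-mono-≤ (+-mono-≤ (+-mono-≤ (+-mono-≤ row-n gap-n) row-s′) s+d≤L) s+d≤L
  excess : ∀ L ps s p d k →
    (L + 2) + suc (p + L) + (L + 2 + (k + 1)) + (s + d) + (s + d)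
    ≡ (p + suc (suc d)) + (k + suc (suc d)) + (L + s + s) + L + L + 2
  excess = solve-∀

module Partition (xs : List ℕ) (isPartition : IsPartition xs) where

  L : ℕ
  L = len xs

  P : ℕ → ℕ
  P = part xs

  part-step : ∀ a → 1 ≤ a → P (suc a) ≤ P a
  part-step a a≥1 with suc a ≤? L
  ... | yes a<L = proj₂ isPartition a a≥1 a<L
  ... | no a≮L = subst (_≤ P a) (sym (part-outside xs (suc a) (≰⇒> a≮L))) z≤n

  antitone : ∀ {a b} → 1 ≤ a → a ≤ b → P b ≤ P a
  antitone {a} a≥1 a≤b with m≤n⇒∃[o]m+o≡n a≤b
  ... | d , refl = descend d
    where
    descend : ∀ d → P (a + d) ≤ P a
    descend zero    = ≤-reflexive (cong P (+-identityʳ a))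
    descend (suc d) = ≤-trans (subst (λ r → P r ≤ P (a + d)) (sym (+-suc a d))
                                     (part-step (a + d) (≤-trans a≥1 (m≤m+n a d))))
                              (descend d)

  column-length : ∀ j m → P (suc m) < j → j ≤ P m → conj xs j ≡ m
  column-length j m below above = conj-exact xs j m
    (λ a a≥1 a≤m → ≤-trans above (antitone a≥1 a≤m))
    (λ a m<a → ≤-<-trans (antitone (s≤s z≤n) m<a) below)

  first-column : conj xs 1 ≡ L
  first-column = conj-exact xs 1 L (proj₁ isPartition)
    (λ a L<a → subst (_< 1) (sym (part-outside xs a L<a)) (s≤s z≤n))

  corner-max : ∀ k → InHk xs k → k ≤ hook xs 1 1
  corner-max k (i , j , (i≥1 , _ , j≥1 , _) , refl) rewrite first-column =
    +-monoˡ-≤ 1 (+-mono-≤ (∸-mono (antitone (s≤s z≤n) i≥1) j≥1)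
                          (∸-mono (length-filter (j ≤?_) xs) i≥1))

  corner-in-Hk : 1 ≤ L → InHk xs (hook xs 1 1)
  corner-in-Hk L≥1 = 1 , 1 , (≤-refl , L≥1 , ≤-refl , proj₁ isPartition 1 ≤-refl L≥1) , refl

  module Gaps (k : ℕ) where

    -- Row i reaches k: its largest hook P i + ℓ - i is at least k.
    Reaches : ℕ → Set
    Reaches i = k + i ≤ P i + L

    reaches? : ∀ i → Dec (Reaches i)
    reaches? i = k + i ≤? P i + L

    -- k is the gap of row i caused by row t: k = (P i - i) - (P t - t).
    BlockedAt : ℕ → ℕ → Set
    BlockedAt i t = P t + (k + i) ≡ P i + t

    Blocked : ℕ → Set
    Blocked i = Σ ℕ λ t → 1 ≤ t × t ≤ L × BlockedAt i t

    NotBlocked : ℕ → Set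
    NotBlocked i = ∀ t → 1 ≤ t → t ≤ L → ¬ BlockedAt i t

    corner-reaches : 1 ≤ L → k ≤ hook xs 1 1 → Reaches 1
    corner-reaches L≥1 k≤h = ≤-trans (+-monoˡ-≤ 1 k≤h)
      (≤-reflexive (trans (cong (λ c → (P 1 ∸ 1) + (c ∸ 1) + 1 + 1) first-column)
                          (pred-sum (proj₁ isPartition 1 ≤-refl L≥1) L≥1)))

    -- A reaching row that is not blocked contains a cell of hook length k:
    -- take the last row m whose leg still makes the hook at least k.
    row-hook : 1 ≤ k → ∀ i → 1 ≤ i → i ≤ L → Reaches i → NotBlocked i → InHk xs k
    row-hook k≥1 i i≥1 i≤L reaches free =
      i , j , (i≥1 , i≤L , ≤-trans (s≤s z≤n) j-below , ≤-trans j≤Pm (antitone i≥1 i≤m)) , hook≡k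
      where
      Long : ℕ → Set
      Long m = P i + m ≤ P m + (k + i)
      start : Long i
      start = +-monoʳ-≤ (P i) (m≤n+m i k)
      stop : ¬ Long (suc L)
      stop long = 1+n≰n (≤-trans (≤-reflexive (sym (+-suc (P i) L)))
        (≤-trans (subst (λ z → P i + suc L ≤ z + (k + i)) (part-outside xs (suc L) ≤-refl) long)
                 reaches))
      crossed = crossing Long (λ m → P i + m ≤? P m + (k + i)) (suc L) (m≤n⇒m≤1+n i≤L) start stop
      m = proj₁ crossed
      i≤m = proj₁ (proj₂ crossed)
      m≤L = ≤-pred (proj₁ (proj₂ (proj₂ crossed)))
      long-m : P i + m < P m + (k + i)
      long-m = ≤∧≢⇒< (proj₁ (proj₂ (proj₂ (proj₂ crossed))))
                     (λ e → free m (≤-trans i≥1 i≤m) m≤L (sym e))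
      short-sm : P (suc m) + (k + i) < P i + suc m
      short-sm = ≰⇒> (proj₂ (proj₂ (proj₂ (proj₂ crossed))))
      j : ℕ
      j = (P i + suc m) ∸ (k + i)
      j-sum : j + (k + i) ≡ P i + suc m
      j-sum = m∸n+n≡m (m+n≤o⇒n≤o (P (suc m)) (<⇒≤ short-sm))
      j-below : P (suc m) < j
      j-below = +-cancelʳ-< (k + i) (P (suc m)) j (subst (P (suc m) + (k + i) <_) (sym j-sum) short-sm)
      j≤Pm : j ≤ P m
      j≤Pm = +-cancelʳ-≤ (k + i) j (P m)
        (subst (_≤ P m + (k + i)) (trans (sym (+-suc (P i) m)) (sym j-sum)) long-m)
      hook≡k : hook xs i j ≡ k
      hook≡k rewrite column-length j m j-below j≤Pm =
        hook-arith (≤-trans j≤Pm (antitone i≥1 i≤m)) i≤m j-sum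

    blocked-below : 1 ≤ k → ∀ {i t} → 1 ≤ t → BlockedAt i t → i < t
    blocked-below k≥1 {i} {t} t≥1 e with i <? t
    ... | yes i<t = i<t
    ... | no i≮t = ⊥-elim (<-irrefl refl (begin-strict
          P i + t       ≤⟨ +-mono-≤ (antitone t≥1 t≤i) t≤i ⟩
          P t + i       <⟨ +-monoʳ-< (P t) (m<n+m i k≥1) ⟩
          P t + (k + i) ≡⟨ e ⟩
          P i + t       ∎))
      where
      open ≤-Reasoning
      t≤i : t ≤ i
      t≤i = ≮⇒≥ i≮t

    blocked-increase : ∀ {n t t′} → 1 ≤ n → 1 ≤ t′ → BlockedAt n t → BlockedAt (suc n) t′ → t < t′
    blocked-increase {n} {t} {t′} n≥1 t′≥1 e e′ with t <? t′
    ... | yes t<t′ = t<t′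
    ... | no t≮t′ = ⊥-elim (<-irrefl refl (begin-strict
          P n + t             ≡⟨ sym e ⟩
          P t + (k + n)       ≤⟨ +-monoˡ-≤ (k + n) (antitone t′≥1 t′≤t) ⟩
          P t′ + (k + n)      <⟨ +-monoʳ-< (P t′) (+-monoʳ-< k (n<1+n n)) ⟩
          P t′ + (k + suc n)  ≡⟨ e′ ⟩
          P (suc n) + t′      ≤⟨ +-mono-≤ (part-step n n≥1) t′≤t ⟩
          P n + t             ∎))
      where
      open ≤-Reasoning
      t′≤t : t′ ≤ t
      t′≤t = ≮⇒≥ t≮t′

    reaches-down : ∀ {n} → 1 ≤ n → Reaches (suc n) → Reaches n
    reaches-down {n} n≥1 r =
      ≤-trans (+-monoʳ-≤ k (n≤1+n n)) (≤-trans r (+-monoˡ-≤ L (part-step n n≥1)))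

    blocked-chain : (∀ i → 1 ≤ i → i ≤ L → Reaches i → Blocked i) →
      ∀ {s} → s ≤ L → BlockedAt 1 s → ∀ d → suc d ≤ L → Reaches (suc d) →
      Σ ℕ λ t → t ≤ L × BlockedAt (suc d) t × s + d ≤ t
    blocked-chain allBlocked {s} s≤L e₁ zero _ _ = s , s≤L , e₁ , ≤-reflexive (+-identityʳ s)
    blocked-chain allBlocked {s} s≤L e₁ (suc d) sd<L r
      with blocked-chain allBlocked s≤L e₁ d (<⇒≤ sd<L) (reaches-down (s≤s z≤n) r)
         | allBlocked (suc (suc d)) (s≤s z≤n) sd<L r
    ... | t , _ , e , s+d≤t | t′ , t′≥1 , t′≤L , e′ =
      t′ , t′≤L , e′ ,
      ≤-trans (≤-reflexive (+-suc s d)) (≤-trans (s≤s s+d≤t) (blocked-increase (s≤s z≤n) t′≥1 e e′))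

    free-or-blocked : Σ ℕ (λ i → 1 ≤ i × i ≤ L × Reaches i × NotBlocked i)
                    ⊎ (∀ i → 1 ≤ i → i ≤ L → Reaches i → Blocked i)
    free-or-blocked = boundedSearch (λ i → Reaches i × NotBlocked i) (λ i → Reaches i → Blocked i) classify L
      where
      classify : ∀ i → (Reaches i × NotBlocked i) ⊎ (Reaches i → Blocked i)
      classify i with reaches? i
      ... | no ¬r = inj₂ (λ r → ⊥-elim (¬r r))
      ... | yes r with boundedSearch (BlockedAt i) (λ t → ¬ BlockedAt i t)
                         (λ t → toSum (P t + (k + i) ≟ P i + t)) L
      ...   | inj₁ (t , t≥1 , t≤L , e) = inj₂ (λ _ → t , t≥1 , t≤L , e)
      ...   | inj₂ free = inj₁ (r , free)

module StrictDyck (xs : List ℕ) (isPartition : IsPartition xs) (nonempty : 1 ≤ len xs)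
  (square : part xs 1 ≡ len xs)
  (tail-long : ∀ i → 1 ≤ i → i ≤ len xs ∸ 1 → part xs ((len xs + 1) ∸ i) > i) where

  open Partition xs isPartition

  -- The tail condition reindexed by rows: λ_a + a ≥ ℓ + 2 for 2 ≤ a ≤ ℓ.
  long-rows : ∀ a → 2 ≤ a → a ≤ L → L + 2 ≤ P a + a
  long-rows (suc (suc a)) (s≤s (s≤s _)) a≤L with m≤n⇒∃[o]m+o≡n a≤L
  ... | d , e = begin
      L + 2                         ≡⟨ cong (_+ 2) (sym e) ⟩
      suc (suc a) + d + 2           ≡⟨ rotate a d ⟩
      suc (suc d) + suc (suc a)     ≤⟨ +-monoˡ-≤ (suc (suc a)) long ⟩
      P (suc (suc a)) + suc (suc a) ∎
    where
    open ≤-Reasoning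
    rotate : ∀ a d → suc (suc a) + d + 2 ≡ suc (suc d) + suc (suc a)
    rotate = solve-∀
    shifted : ∀ a d → suc (suc a) + d + 1 ≡ suc (suc a) + suc d
    shifted = solve-∀
    row : (L + 1) ∸ suc d ≡ suc (suc a)
    row = trans (cong (_∸ suc d) (trans (cong (_+ 1) (sym e)) (shifted a d)))
                (m+n∸n≡m (suc (suc a)) (suc d))
    in-range : suc d ≤ L ∸ 1
    in-range = subst (suc d ≤_) (cong (_∸ 1) e) (s≤s (m≤n+m d a))
    long : P (suc (suc a)) > suc d
    long = subst (λ r → P r > suc d) row (tail-long (suc d) (s≤s z≤n) in-range)

  module _ (k : ℕ) (k≥1 : 1 ≤ k) where
    open Gaps k

    -- Not every reaching row can be blocked: follow the blocking rows from
    -- row 1 down to the last reaching row.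
    no-total-blocking : Reaches 1 → (∀ i → 1 ≤ i → i ≤ L → Reaches i → Blocked i) → ⊥
    no-total-blocking reaches₁ allBlocked
      with allBlocked 1 ≤-refl nonempty reaches₁
    ... | s , s≥1 , s≤L , e₁
      with crossing Reaches reaches? (suc L) (s≤s z≤n) reaches₁ beyond
      where
      beyond : ¬ Reaches (suc L)
      beyond r = 1+n≰n (≤-trans (m≤n+m (suc L) k)
                         (subst (λ p → k + suc L ≤ p + L) (part-outside xs (suc L) ≤-refl) r))
    ... | suc d , _ , n<1+L , reaches-n , ¬reaches-sn
      with blocked-chain allBlocked s≤L e₁ d (≤-pred n<1+L) reaches-n
    ... | t , t≤L , _ , s+d≤t =
      blocking-arith (trans e₁ (cong (_+ s) square)) (long-rows s s≥2 s≤L)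
                     (long-rows (suc (suc d)) (s≤s (s≤s z≤n)) sn≤L) (≰⇒> ¬reaches-sn) s+d≤L
      where
      s≥2 : 2 ≤ s
      s≥2 = blocked-below k≥1 s≥1 e₁
      s+d≤L : s + d ≤ L
      s+d≤L = ≤-trans s+d≤t t≤L
      sn≤L : suc (suc d) ≤ L
      sn≤L = ≤-trans (+-monoˡ-≤ d s≥2) s+d≤L

    all-hooks : k ≤ hook xs 1 1 → InHk xs k
    all-hooks k≤h with free-or-blocked
    ... | inj₁ (i , i≥1 , i≤L , r , free) = row-hook k≥1 i i≥1 i≤L r free
    ... | inj₂ allBlocked = ⊥-elim (no-total-blocking (corner-reaches nonempty k≤h) allBlocked)

corollary2 : (λs : List ℕ) → IsPartition λs → 1 ≤ len λs
    → part λs 1 ≡ len λs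
    → (∀ i → 1 ≤ i → i ≤ len λs ∸ 1 → part λs ((len λs + 1) ∸ i) > i)
    → Σ ℕ (λ h → (InHk λs h × (∀ k → InHk λs k → k ≤ h))
    × (∀ k → (InHk λs k → 1 ≤ k × k ≤ h) × (1 ≤ k × k ≤ h → InHk λs k)))
corollary2 λs isPartition nonempty square tail-long =
  hook λs 1 1 , (corner-in-Hk nonempty , corner-max) ,
  λ k → (λ k∈Hk → hook-positive λs k∈Hk , corner-max k k∈Hk) ,
        (λ { (k≥1 , k≤h) → all-hooks k k≥1 k≤h })
  where
  open Partition λs isPartition
  open StrictDyck λs isPartition nonempty square tail-long
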